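{- Let $n$ be a positive integer, let $\mathcal{C}$ be a class of matroids (closed under restriction) each with at most $n$ elements, and let $(f_{\mathbf{M},\pi})$ be an online matroid morphism of $\mathcal{C}$ into a matroid $\mathbf{BigM}$. Then there is an online matroid embedding $(f'_{\mathbf{M},\pi})$ of $\mathcal{C}$ into $\mathbf{BigM}_{[n]}$.
   Context: A morphism $f:\mathbf{M}\to\mathbf{N}$ is a map of ground sets with $\mathrm{rank}_{\mathbf{N}}(f(S))=\mathrm{rank}_{\mathbf{M}}(S)$ for all $S$; an embedding is an injective morphism. For a matroid $\mathbf{M}$ and $k\ge1$, $\mathbf{M}_{[k]}$ has ground set $\{(u,j):u\in\mathbf{M},j\in[k]\}$ and rank function $\mathrm{rank}_{\mathbf{M}_{[k]}}(S)=\mathrm{rank}_{\mathbf{M}}(\phi(S))$, $\phi(u,j)=u$. An ordering of $\mathbf{M}$ with $|\mathbf{M}|=m$ is a bijection $\pi:[m]\to\mathbf{M}$; for $m'<m$ the prefix-restriction $(\mathbf{M}',\pi')$ is the restriction of $\mathbf{M}$ to $\pi([m'])$ with $\pi'=\pi|_{[m']}$. An online matroid morphism (resp. embedding) of $\mathcal{C}$ into $\mathbf{BigM}$ is a family of morphisms (resp. injective morphisms) $f_{\mathbf{M},\pi}:\mathbf{M}\to\mathbf{BigM}$ for all $\mathbf{M}\in\mathcal{C}$ and orderings $\pi$, such that for every prefix-restriction $(\mathbf{M}',\pi')$ of $(\mathbf{M},\pi)$, $f_{\mathbf{M}',\pi'}$ is the restriction of $f_{\mathbf{M},\pi}$ to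 $\mathbf{M}'$. -}

module Defs where

open import Data.Nat using (ℕ; zero; suc; _≤_; _<_; _<ᵇ_)
open import Data.Nat.Properties using (<⇒≤)
open import Data.Fin using (Fin; toℕ; inject≤)
open import Data.Bool using (Bool; T)
open import Data.List using (List; []; _∷_; map)
open import Data.List.Membership.Propositional using (_∈_)
open import Data.List.Membership.Propositional.Properties using (∈-map⁺; ∈-map⁻)
open import Data.Product using (Σ; Σ-syntax; _×_; _,_; proj₁; proj₂; ∃)
open import Function.Bundles using (_↔_; Inverse)
open import Function.Definitions using (Injective)
open import Relation.Binary.PropositionalEquality using (_≡_; refl; subst; sym)

-- Matroids, given by a rank function on finite subsets of the ground
-- set (finite subsets represented by lists; the rank only depends on
-- the underlying set).  Axioms: the standard "unit increase + local
-- submodularity" rank axioms (R1')-(R3').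

record Matroid : Set₁ where
  field
    E        : Set
    rank     : List E → ℕ
    rank-set : ∀ (S T : List E) → (∀ x → x ∈ S → x ∈ T) → (∀ x → x ∈ T → x ∈ S)
               → rank S ≡ rank T
    rank-[]  : rank [] ≡ 0
    rank-inc : ∀ x S → rank S ≤ rank (x ∷ S)
    rank-unit : ∀ x S → rank (x ∷ S) ≤ suc (rank S)
    rank-loc : ∀ x y S → rank (x ∷ S) ≡ rank S → rank (y ∷ S) ≡ rank S
               → rank (x ∷ y ∷ S) ≡ rank S

open Matroid public

pullback : (M : Matroid) {F : Set} → (F → E M) → Matroid
pullback M {F} g = record
  { E = F
  ; rank = λ S → rank M (map g S)
  ; rank-set = λ S T s⊆t t⊆s → rank-set M (map g S) (map g T) (sub s⊆t) (sub t⊆s)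
  ; rank-[] = rank-[] M
  ; rank-inc = λ x S → rank-inc M (g x) (map g S)
  ; rank-unit = λ x S → rank-unit M (g x) (map g S)
  ; rank-loc = λ x y S → rank-loc M (g x) (g y) (map g S)
  }
  where
  sub : ∀ {S T : List F} → (∀ x → x ∈ S → x ∈ T) → ∀ y → y ∈ map g S → y ∈ map g T
  sub {S} s⊆t y y∈ with ∈-map⁻ g y∈
  ... | x , x∈S , refl = ∈-map⁺ g (s⊆t x x∈S)

restrict : (M : Matroid) → (E M → Bool) → Matroid
restrict M P = pullback M {Σ (E M) (λ x → T (P x))} proj₁

_[_] : Matroid → ℕ → Matroid
M [ k ] = pullback M {E M × Fin k} proj₁

IsMorphism : (M N : Matroid) → (E M → E N) → Set
IsMorphism M N f = ∀ (S : List (E M)) → rank N (map f S) ≡ rank M S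

IsEmbedding : (M N : Matroid) → (E M → E N) → Set
IsEmbedding M N f = IsMorphism M N f × Injective _≡_ _≡_ f

Ordering : Matroid → ℕ → Set
Ordering M m = Fin m ↔ E M

prefixSet : (M : Matroid) {m : ℕ} → Ordering M m → ℕ → E M → Bool
prefixSet M π m' x = toℕ (Inverse.from π x) <ᵇ m'

prefixMatroid : (M : Matroid) {m : ℕ} → Ordering M m → ℕ → Matroid
prefixMatroid M π m' = restrict M (prefixSet M π m')

Class : Set₁
Class = Matroid → Set

ClosedUnderRestriction : Class → Set₁
ClosedUnderRestriction C = ∀ M → C M → (P : E M → Bool) → C (restrict M P)

AtMost : ℕ → Matroid → Set
AtMost n M = Σ[ m ∈ ℕ ] (m ≤ n × (Fin m ↔ E M))

Family : Class → Matroid → Set₁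
Family C N = (M : Matroid) → C M → (m : ℕ) → Ordering M m → E M → E N

PrefixConsistent : (C : Class) (N : Matroid) → Family C N → Set₁
PrefixConsistent C N f =
  ∀ (M : Matroid) (c : C M) (m : ℕ) (π : Ordering M m) (m' : ℕ) (m'<m : m' < m)
    (c' : C (prefixMatroid M π m')) (π' : Ordering (prefixMatroid M π m') m')
  → (∀ (i : Fin m') → proj₁ (Inverse.to π' i) ≡ Inverse.to π (inject≤ i (<⇒≤ m'<m)))
  → ∀ (x : E (prefixMatroid M π m')) → f (prefixMatroid M π m') c' m' π' x ≡ f M c m π (proj₁ x)

IsOnlineMorphism : (C : Class) (N : Matroid) → Family C N → Set₁
IsOnlineMorphism C N f =
  (∀ (M : Matroid) (c : C M) (m : ℕ) (π : Ordering M m) → IsMorphism M N (f M c m π))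
  × PrefixConsistent C N f

IsOnlineEmbedding : (C : Class) (N : Matroid) → Family C N → Set₁
IsOnlineEmbedding C N f =
  (∀ (M : Matroid) (c : C M) (m : ℕ) (π : Ordering M m) → IsEmbedding M N (f M c m π))
  × PrefixConsistent C N f

{-# OPTIONS --safe #-}
-- Tag each image f_{M,π}(x) with the position of x in π, read as an element
-- of [n] (possible as |M| ≤ n).  Distinct elements get distinct positions,
-- so the tagged maps are injective; the rank only sees the first coordinate,
-- so they remain morphisms; and a prefix ordering assigns every element the
-- same position as the full ordering, so online consistency is inherited
-- from f.
module Submission where

open import Defs
open import Data.Nat using (ℕ; _≤_)
open import Data.Nat.Properties using (≤-reflexive; ≤-trans; <⇒≤)
open import Data.Product using (Σ; _,_; proj₁; proj₂)
open import Data.Fin using (Fin; toℕ; inject≤)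
open import Data.Fin.Properties using (toℕ-injective; toℕ-inject≤; inject≤-injective)
open import Data.Fin.Permutation using (↔⇒≡)
open import Data.List.Properties using (map-∘)
open import Function.Base using (_∘_)
open import Function.Bundles using (_↔_; Inverse; Injection)
open import Function.Definitions using (Injective)
open import Function.Properties.Inverse using (↔-sym; ↔-trans; ↔⇒↣)
open import Relation.Binary.PropositionalEquality using (_≡_; refl; sym; trans; cong; cong₂; module ≡-Reasoning)

ordering-length-unique : ∀ {A : Set} {m k : ℕ} → Fin m ↔ A → Fin k ↔ A → m ≡ k
ordering-length-unique π ρ = ↔⇒≡ (↔-trans π (↔-sym ρ))

ordering-length-≤ : ∀ {n} M {m} → AtMost n M → Ordering M m → m ≤ n
ordering-length-≤ M (m₀ , m₀≤n , ρ) π = ≤-trans (≤-reflexive (ordering-length-unique π ρ)) m₀≤n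

position : ∀ {n} M {m} → Ordering M m → m ≤ n → E M → Fin n
position M π m≤n x = inject≤ (Inverse.from π x) m≤n

position-injective : ∀ {n} M {m} (π : Ordering M m) (m≤n : m ≤ n) → Injective _≡_ _≡_ (position M π m≤n)
position-injective M π m≤n =
  Injection.injective (↔⇒↣ (↔-sym π)) ∘ inject≤-injective m≤n m≤n _ _

prefix-from : ∀ M {m} (π : Ordering M m) {m'} (m'≤m : m' ≤ m) (π' : Ordering (prefixMatroid M π m') m')
  → (∀ i → proj₁ (Inverse.to π' i) ≡ Inverse.to π (inject≤ i m'≤m))
  → ∀ x → Inverse.from π (proj₁ x) ≡ inject≤ (Inverse.from π' x) m'≤m
prefix-from M π m'≤m π' π'⊆π x = begin
  Inverse.from π (proj₁ x)                   ≡⟨ cong (Inverse.from π ∘ proj₁) (sym (Inverse.strictlyInverseˡ π' x)) ⟩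
  Inverse.from π (proj₁ (Inverse.to π' i))   ≡⟨ cong (Inverse.from π) (π'⊆π i) ⟩
  Inverse.from π (Inverse.to π (inject≤ i m'≤m)) ≡⟨ Inverse.strictlyInverseʳ π _ ⟩
  inject≤ i m'≤m                             ∎
  where
  open ≡-Reasoning
  i = Inverse.from π' x

prefix-position : ∀ {n} M {m} (π : Ordering M m) (m≤n : m ≤ n) {m'} (m'≤m : m' ≤ m)
  (π' : Ordering (prefixMatroid M π m') m') (m'≤n : m' ≤ n)
  → (∀ i → proj₁ (Inverse.to π' i) ≡ Inverse.to π (inject≤ i m'≤m))
  → ∀ x → position (prefixMatroid M π m') π' m'≤n x ≡ position M π m≤n (proj₁ x)
prefix-position M π m≤n m'≤m π' m'≤n π'⊆π x = toℕ-injective (begin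
  toℕ (inject≤ i m'≤n)                          ≡⟨ toℕ-inject≤ i m'≤n ⟩
  toℕ i                                         ≡⟨ sym (toℕ-inject≤ i m'≤m) ⟩
  toℕ (inject≤ i m'≤m)                          ≡⟨ cong toℕ (sym (prefix-from M π m'≤m π' π'⊆π x)) ⟩
  toℕ (Inverse.from π (proj₁ x))                ≡⟨ sym (toℕ-inject≤ _ m≤n) ⟩
  toℕ (inject≤ (Inverse.from π (proj₁ x)) m≤n)  ∎)
  where
  open ≡-Reasoning
  i = Inverse.from π' x

lemma1 : (n : ℕ) → 1 ≤ n → (C : Class) → ClosedUnderRestriction C
    → (∀ M → C M → AtMost n M) → (BigM : Matroid) → (f : Family C BigM)
    → IsOnlineMorphism C BigM f
    → Σ (Family C (BigM [ n ])) (IsOnlineEmbedding C (BigM [ n ]))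
lemma1 n _ C _ atMost BigM f (f-morphism , f-consistent) = f' , f'-embedding , f'-consistent
  where
  length≤n : ∀ M (c : C M) {m} → Ordering M m → m ≤ n
  length≤n M c = ordering-length-≤ M (atMost M c)

  f' : Family C (BigM [ n ])
  f' M c m π x = f M c m π x , position M π (length≤n M c π) x

  f'-embedding : ∀ M c m π → IsEmbedding M (BigM [ n ]) (f' M c m π)
  f'-embedding M c m π =
    (λ S → trans (cong (rank BigM) (sym (map-∘ S))) (f-morphism M c m π S)) ,
    position-injective M π (length≤n M c π) ∘ cong proj₂

  f'-consistent : PrefixConsistent C (BigM [ n ]) f'
  f'-consistent M c m π m' m'<m c' π' π'⊆π x =
    cong₂ _,_ (f-consistent M c m π m' m'<m c' π' π'⊆π x)
              (prefix-position M π (length≤n M c π) (<⇒≤ m'<m) π' (length≤n _ c' π') π'⊆π x)
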